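{- In $\mathbb{Z}[x,y]$, the polynomials $D_1=y^2+2y+1$ and $D_2=x-y$ form a (D-)Gröbner basis for the ideal generated by the polynomials of the tiles of $\mathcal{T}_4^+$, namely $y^2+y+1+x$, $y^2+xy^2+xy+x$, $y+1+x+x^2$, $x^2+y+xy+x^2y$, $xy+x+y+1$.
   Context: Terms in $\mathbb{Z}[x,y]$ are ordered by degree-lexicographic order with $x>y$: $1<y<x<y^2<xy<x^2<y^3<\cdots$. For $P\neq0$, $HM(P)$ is its leading monomial. $f$ D-reduces to $g$ modulo $p$ if some monomial $m$ of $f$ equals $m'\cdot HM(p)$ for a monomial $m'$ with integer coefficient, and $g=f-m'p$; a D-normal form modulo a finite set $G$ is obtained by repeated such reductions until none applies. A finite set $G$ is a D-Gröbner basis if all D-normal forms modulo $G$ of elements of the ideal $I(G)$ are $0$; it is a Gröbner basis of an ideal $I$ if moreover $I(G)=I$. -}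

module Defs where

open import Data.Nat as ℕ using (ℕ)
open import Data.Integer as ℤ using (ℤ; +_; -_)
open import Data.Product using (Σ; ∃; _×_; _,_; proj₁; proj₂)
open import Data.Sum using (_⊎_)
open import Data.List using (List; []; _∷_; _++_; map; concatMap)
open import Data.List.Membership.Propositional using (_∈_)
open import Data.List.Relation.Unary.All using (All)
open import Relation.Binary.PropositionalEquality using (_≡_; _≢_)
open import Relation.Binary.Construct.Closure.ReflexiveTransitive using (Star)
open import Relation.Nullary using (¬_; yes; no)
open import Function.Bundles using (_⇔_)

-- A term c · x^i · y^j is represented as (c , i , j).
Term : Set
Term = ℤ × ℕ × ℕ

-- A polynomial of ℤ[x,y] is represented as a finite formal sum of terms;
-- two representations denote the same polynomial iff they have the same
-- coefficient function (see _≈ₚ_).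
Poly : Set
Poly = List Term

coeff : Poly → ℕ → ℕ → ℤ
coeff [] i j = + 0
coeff ((c , a , b) ∷ p) i j with a ℕ.≟ i | b ℕ.≟ j
... | yes _ | yes _ = c ℤ.+ coeff p i j
... | _     | _     = coeff p i j

_≈ₚ_ : Poly → Poly → Set
p ≈ₚ q = ∀ i j → coeff p i j ≡ coeff q i j

0ₚ : Poly
0ₚ = []

_+ₚ_ : Poly → Poly → Poly
p +ₚ q = p ++ q

-ₚ_ : Poly → Poly
-ₚ p = map (λ { (c , a , b) → (- c , a , b) }) p

_-ₚ_ : Poly → Poly → Poly
p -ₚ q = p +ₚ (-ₚ q)

_*ₚ_ : Poly → Poly → Poly
p *ₚ q = concatMap (λ { (c , a , b) → map (λ { (d , i , j) → (c ℤ.* d , a ℕ.+ i , b ℕ.+ j) }) q }) p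

mono : ℤ → ℕ → ℕ → Poly
mono d i j = (d , i , j) ∷ []

-- Degree-lexicographic order with x > y on exponent pairs (i , j) ↦ x^i y^j:
-- strictly smaller total degree, or same total degree and smaller x-exponent.
_<ᵈˡ_ : ℕ × ℕ → ℕ × ℕ → Set
(i , j) <ᵈˡ (a , b) = (i ℕ.+ j ℕ.< a ℕ.+ b) ⊎ ((i ℕ.+ j ≡ a ℕ.+ b) × (i ℕ.< a))

IsHM : Poly → ℤ → ℕ → ℕ → Set
IsHM p c a b =
  (coeff p a b ≡ c) × (c ≢ + 0) ×
  (∀ i j → coeff p i j ≢ + 0 → ((i , j) ≡ (a , b)) ⊎ ((i , j) <ᵈˡ (a , b)))

DReduces : Poly → Poly → Poly → Set
DReduces p f g =
  Σ ℤ λ c → Σ ℕ λ a → Σ ℕ λ b → IsHM p c a b ×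
  (Σ ℤ λ d → Σ ℕ λ i → Σ ℕ λ j →
     (coeff f (i ℕ.+ a) (j ℕ.+ b) ≢ + 0) ×
     (coeff f (i ℕ.+ a) (j ℕ.+ b) ≡ d ℤ.* c) ×
     (g ≈ₚ (f -ₚ (mono d i j *ₚ p))))

DReducesMod : List Poly → Poly → Poly → Set
DReducesMod G f g = Σ Poly λ p → (p ∈ G) × DReduces p f g

IsDNormalForm : List Poly → Poly → Poly → Set
IsDNormalForm G f h = Star (DReducesMod G) f h × (∀ g → ¬ DReducesMod G h g)

lincomb : List (Poly × Poly) → Poly
lincomb [] = 0ₚ
lincomb ((h , g) ∷ cs) = (h *ₚ g) +ₚ lincomb cs

InIdeal : List Poly → Poly → Set
InIdeal G f = Σ (List (Poly × Poly)) λ cs →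
  All (λ hg → proj₂ hg ∈ G) cs × (f ≈ₚ lincomb cs)

IsDGroebner : List Poly → Set
IsDGroebner G = ∀ f → InIdeal G f → ∀ h → IsDNormalForm G f h → h ≈ₚ 0ₚ

IsGroebnerBasisOf : List Poly → List Poly → Set
IsGroebnerBasisOf G T = IsDGroebner G × (∀ f → InIdeal G f ⇔ InIdeal T f)

D₁ : Poly
D₁ = (+ 1 , 0 , 2) ∷ (+ 2 , 0 , 1) ∷ (+ 1 , 0 , 0) ∷ []

D₂ : Poly
D₂ = (+ 1 , 1 , 0) ∷ (- + 1 , 0 , 1) ∷ []

T₁ : Poly
T₁ = (+ 1 , 0 , 2) ∷ (+ 1 , 0 , 1) ∷ (+ 1 , 0 , 0) ∷ (+ 1 , 1 , 0) ∷ []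
T₂ : Poly
T₂ = (+ 1 , 0 , 2) ∷ (+ 1 , 1 , 2) ∷ (+ 1 , 1 , 1) ∷ (+ 1 , 1 , 0) ∷ []
T₃ : Poly
T₃ = (+ 1 , 0 , 1) ∷ (+ 1 , 0 , 0) ∷ (+ 1 , 1 , 0) ∷ (+ 1 , 2 , 0) ∷ []
T₄ : Poly
T₄ = (+ 1 , 2 , 0) ∷ (+ 1 , 0 , 1) ∷ (+ 1 , 1 , 1) ∷ (+ 1 , 2 , 1) ∷ []
T₅ : Poly
T₅ = (+ 1 , 1 , 1) ∷ (+ 1 , 1 , 0) ∷ (+ 1 , 0 , 1) ∷ (+ 1 , 0 , 0) ∷ []

-- D-reduction only subtracts multiples of D₁ and D₂, so a D-normal form h of an element of
-- I(D₁, D₂) stays in that ideal. The evaluation x, y ↦ t into ℤ[t]/((t+1)²) kills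
-- D₁ = (y+1)² and D₂ = x - y, hence h. But h is irreducible, so no monomial of h is divisible
-- by HM(D₂) = x or HM(D₁) = y²: h = c₀ + c₁ y, whose image c₀ + c₁ t is zero only if c₀ = c₁ = 0.
-- The two ideals coincide by explicit cofactors.
--
-- Polynomials are handled through the linear functionals ⟪ w , _ ⟫ given by weights on
-- monomials. These respect ≈ₚ, and the coefficient functionals separate polynomials, so ring
-- laws of the list representation up to ≈ₚ reduce to identities between pairings.
module Submission where

open import Defs
open import Data.List using (List; []; _∷_; _++_; map)
open import Data.List.Properties using (++-assoc; ++-identityʳ)
open import Data.List.Relation.Unary.All using (All; []; _∷_; lookup)
open import Data.List.Relation.Unary.All.Properties using (++⁺; map⁺)
open import Data.List.Relation.Unary.Any using (here; there)
open import Data.List.Membership.Propositional using (_∈_)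
open import Data.Nat as ℕ using (ℕ; zero; suc)
import Data.Nat.Properties as ℕ
open import Data.Integer using (ℤ; +_; -_; _+_; _*_; _-_)
import Data.Integer as ℤ
import Data.Integer.Properties as ℤ
open import Data.Integer.Tactic.RingSolver using (solve-∀)
open import Data.Product using (_×_; _,_; proj₁; proj₂)
open import Data.Product.Properties using (≡-dec)
open import Data.Sum using (_⊎_; inj₁; inj₂)
open import Data.Empty using (⊥-elim)
open import Function.Base using (_∘_)
open import Algebra.Properties.CommutativeSemigroup ℕ.+-commutativeSemigroup
  using () renaming (interchange to +-interchange)
open import Relation.Nullary using (¬_; Dec; yes; no)
open import Relation.Binary.PropositionalEquality
open import Relation.Binary.Construct.Closure.ReflexiveTransitive using (Star; ε; _◅_)
open import Function.Bundles using (mk⇔)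

Weight : Set
Weight = ℕ → ℕ → ℤ

⟪_,_⟫ : Weight → Poly → ℤ
⟪ w , [] ⟫ = + 0
⟪ w , (c , a , b) ∷ p ⟫ = c * w a b + ⟪ w , p ⟫

⟪⟫-++ : ∀ w p q → ⟪ w , p ++ q ⟫ ≡ ⟪ w , p ⟫ + ⟪ w , q ⟫
⟪⟫-++ w [] q = sym (ℤ.+-identityˡ _)
⟪⟫-++ w ((c , a , b) ∷ p) q =
  trans (cong (_+_ (c * w a b)) (⟪⟫-++ w p q)) (sym (ℤ.+-assoc (c * w a b) _ _))

⟪⟫-neg : ∀ w p → ⟪ w , -ₚ p ⟫ ≡ - ⟪ w , p ⟫
⟪⟫-neg w [] = refl
⟪⟫-neg w ((c , a , b) ∷ p) = trans (cong (_+_ (- c * w a b)) (⟪⟫-neg w p)) (distrib c (w a b) ⟪ w , p ⟫)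
  where
  distrib : ∀ c x s → - c * x + - s ≡ - (c * x + s)
  distrib = solve-∀

⟪⟫-linear : ∀ {w} u v α β → (∀ i j → w i j ≡ α * u i j + β * v i j) →
            ∀ p → ⟪ w , p ⟫ ≡ α * ⟪ u , p ⟫ + β * ⟪ v , p ⟫
⟪⟫-linear u v α β w≡ [] = zero≡ α β
  where
  zero≡ : ∀ α β → + 0 ≡ α * + 0 + β * + 0
  zero≡ = solve-∀
⟪⟫-linear u v α β w≡ ((c , a , b) ∷ p)
  rewrite w≡ a b | ⟪⟫-linear u v α β w≡ p = regroup c α β (u a b) (v a b) ⟪ u , p ⟫ ⟪ v , p ⟫
  where
  regroup : ∀ c α β x y U V → c * (α * x + β * y) + (α * U + β * V) ≡ α * (c * x + U) + β * (c * y + V)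
  regroup = solve-∀

⟪⟫-congˡ : ∀ {w v} → (∀ i j → w i j ≡ v i j) → ∀ p → ⟪ w , p ⟫ ≡ ⟪ v , p ⟫
⟪⟫-congˡ w≗v [] = refl
⟪⟫-congˡ w≗v ((c , a , b) ∷ p) = cong₂ (λ x y → c * x + y) (w≗v a b) (⟪⟫-congˡ w≗v p)

-- The indicator weight of (a , b), defined through coeff so that it unfolds in step with coeff.
δ : ℕ → ℕ → Weight
δ a b i j = coeff (mono (+ 1) i j) a b

coeff-∷ : ∀ c i j p a b → coeff ((c , i , j) ∷ p) a b ≡ c * δ a b i j + coeff p a b
coeff-∷ c i j p a b with i ℕ.≟ a | j ℕ.≟ b
... | yes _ | yes _ = cong (_+ coeff p a b) (sym (ℤ.*-identityʳ c))
... | yes _ | no _  = sym (trans (cong (_+ coeff p a b) (ℤ.*-zeroʳ c)) (ℤ.+-identityˡ _))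
... | no _  | _     = sym (trans (cong (_+ coeff p a b) (ℤ.*-zeroʳ c)) (ℤ.+-identityˡ _))

coeff≡⟪δ⟫ : ∀ p a b → coeff p a b ≡ ⟪ δ a b , p ⟫
coeff≡⟪δ⟫ [] a b = refl
coeff≡⟪δ⟫ ((c , i , j) ∷ p) a b = trans (coeff-∷ c i j p a b) (cong (_+_ (c * δ a b i j)) (coeff≡⟪δ⟫ p a b))

coeff-++ : ∀ p q i j → coeff (p ++ q) i j ≡ coeff p i j + coeff q i j
coeff-++ p q i j = begin
  coeff (p ++ q) i j                       ≡⟨ coeff≡⟪δ⟫ (p ++ q) i j ⟩
  ⟪ δ i j , p ++ q ⟫                       ≡⟨ ⟪⟫-++ (δ i j) p q ⟩
  ⟪ δ i j , p ⟫ + ⟪ δ i j , q ⟫            ≡⟨ sym (cong₂ _+_ (coeff≡⟪δ⟫ p i j) (coeff≡⟪δ⟫ q i j)) ⟩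
  coeff p i j + coeff q i j                ∎
  where open ≡-Reasoning

coeff-neg : ∀ p i j → coeff (-ₚ p) i j ≡ - coeff p i j
coeff-neg p i j = begin
  coeff (-ₚ p) i j    ≡⟨ coeff≡⟪δ⟫ (-ₚ p) i j ⟩
  ⟪ δ i j , -ₚ p ⟫    ≡⟨ ⟪⟫-neg (δ i j) p ⟩
  - ⟪ δ i j , p ⟫     ≡⟨ cong -_ (sym (coeff≡⟪δ⟫ p i j)) ⟩
  - coeff p i j       ∎
  where open ≡-Reasoning

coeff-∷-hit : ∀ c a b p → coeff ((c , a , b) ∷ p) a b ≡ c + coeff p a b
coeff-∷-hit c a b p with a ℕ.≟ a | b ℕ.≟ b
... | yes _ | yes _ = refl
... | no a≢a | _    = ⊥-elim (a≢a refl)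
... | yes _ | no b≢b = ⊥-elim (b≢b refl)

coeff-∷-miss : ∀ c a b p {i j} → (a , b) ≢ (i , j) → coeff ((c , a , b) ∷ p) i j ≡ coeff p i j
coeff-∷-miss c a b p {i} {j} ne with a ℕ.≟ i | b ℕ.≟ j
... | yes refl | yes refl = ⊥-elim (ne refl)
... | yes _    | no _     = refl
... | no _     | _        = refl

_≟²_ : (x y : ℕ × ℕ) → Dec (x ≡ y)
_≟²_ = ≡-dec ℕ._≟_ ℕ._≟_

erase : Weight → ℕ → ℕ → Weight
erase w a b i j with (i , j) ≟² (a , b)
... | yes _ = + 0
... | no _  = w i j

⟪⟫-split : ∀ w a b p → ⟪ w , p ⟫ ≡ ⟪ erase w a b , p ⟫ + coeff p a b * w a b
⟪⟫-split w a b [] = sym (trans (ℤ.+-identityˡ _) (ℤ.*-zeroˡ (w a b)))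
⟪⟫-split w a b ((c , i , j) ∷ p) with (i , j) ≟² (a , b)
... | yes refl = begin
  c * w i j + ⟪ w , p ⟫
    ≡⟨ cong (_+_ (c * w i j)) (⟪⟫-split w i j p) ⟩
  c * w i j + (⟪ erase w i j , p ⟫ + coeff p i j * w i j)
    ≡⟨ regroup c (w i j) ⟪ erase w i j , p ⟫ (coeff p i j) ⟩
  c * + 0 + ⟪ erase w i j , p ⟫ + (c + coeff p i j) * w i j
    ≡⟨ sym (cong (λ k → c * + 0 + ⟪ erase w i j , p ⟫ + k * w i j) (coeff-∷-hit c i j p)) ⟩
  c * + 0 + ⟪ erase w i j , p ⟫ + coeff ((c , i , j) ∷ p) i j * w i j
    ∎
  where
  open ≡-Reasoning
  regroup : ∀ c x E C → c * x + (E + C * x) ≡ c * + 0 + E + (c + C) * x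
  regroup = solve-∀
... | no ne = begin
  c * w i j + ⟪ w , p ⟫
    ≡⟨ cong (_+_ (c * w i j)) (⟪⟫-split w a b p) ⟩
  c * w i j + (⟪ erase w a b , p ⟫ + coeff p a b * w a b)
    ≡⟨ sym (ℤ.+-assoc (c * w i j) _ _) ⟩
  c * w i j + ⟪ erase w a b , p ⟫ + coeff p a b * w a b
    ≡⟨ sym (cong (λ k → c * w i j + ⟪ erase w a b , p ⟫ + k * w a b) (coeff-∷-miss c i j p ne)) ⟩
  c * w i j + ⟪ erase w a b , p ⟫ + coeff ((c , i , j) ∷ p) a b * w a b
    ∎
  where open ≡-Reasoning

-- Weighting the hypothesis by w lets the induction erase the weight at the head exponent.
⟪⟫-vanishes : ∀ w p → (∀ i j → coeff p i j * w i j ≡ + 0) → ⟪ w , p ⟫ ≡ + 0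
⟪⟫-vanishes w [] _ = refl
⟪⟫-vanishes w ((c , a , b) ∷ p) p·w≡0 = begin
  c * w a b + ⟪ w , p ⟫
    ≡⟨ cong (_+_ (c * w a b)) (⟪⟫-split w a b p) ⟩
  c * w a b + (⟪ erase w a b , p ⟫ + coeff p a b * w a b)
    ≡⟨ cong (λ e → c * w a b + (e + coeff p a b * w a b)) (⟪⟫-vanishes (erase w a b) p tail·erased≡0) ⟩
  c * w a b + (+ 0 + coeff p a b * w a b)
    ≡⟨ regroup c (coeff p a b) (w a b) ⟩
  (c + coeff p a b) * w a b
    ≡⟨ cong (_* w a b) (sym (coeff-∷-hit c a b p)) ⟩
  coeff ((c , a , b) ∷ p) a b * w a b
    ≡⟨ p·w≡0 a b ⟩
  + 0
    ∎
  where
  open ≡-Reasoning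
  regroup : ∀ c C x → c * x + (+ 0 + C * x) ≡ (c + C) * x
  regroup = solve-∀
  tail·erased≡0 : ∀ i j → coeff p i j * erase w a b i j ≡ + 0
  tail·erased≡0 i j with (i , j) ≟² (a , b)
  ... | yes _ = ℤ.*-zeroʳ (coeff p i j)
  ... | no ne = trans (cong (_* w i j) (sym (coeff-∷-miss c a b p (ne ∘ sym)))) (p·w≡0 i j)

⟪⟫-congʳ : ∀ w p q → p ≈ₚ q → ⟪ w , p ⟫ ≡ ⟪ w , q ⟫
⟪⟫-congʳ w p q p≈q = ℤ.i-j≡0⇒i≡j _ _ (begin
  ⟪ w , p ⟫ - ⟪ w , q ⟫      ≡⟨ cong (_+_ ⟪ w , p ⟫) (sym (⟪⟫-neg w q)) ⟩
  ⟪ w , p ⟫ + ⟪ w , -ₚ q ⟫   ≡⟨ sym (⟪⟫-++ w p (-ₚ q)) ⟩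
  ⟪ w , p -ₚ q ⟫             ≡⟨ ⟪⟫-vanishes w (p -ₚ q) difference·w≡0 ⟩
  + 0                        ∎)
  where
  open ≡-Reasoning
  difference·w≡0 : ∀ i j → coeff (p -ₚ q) i j * w i j ≡ + 0
  difference·w≡0 i j = begin
    coeff (p -ₚ q) i j * w i j              ≡⟨ cong (_* w i j) (coeff-++ p (-ₚ q) i j) ⟩
    (coeff p i j + coeff (-ₚ q) i j) * w i j ≡⟨ cong (λ n → (coeff p i j + n) * w i j) (coeff-neg q i j) ⟩
    (coeff p i j - coeff q i j) * w i j     ≡⟨ cong (_* w i j) (ℤ.i≡j⇒i-j≡0 (p≈q i j)) ⟩
    + 0 * w i j                             ≡⟨ ℤ.*-zeroˡ (w i j) ⟩
    + 0                                     ∎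

≈ₚ-from-⟪⟫ : ∀ p q → (∀ w → ⟪ w , p ⟫ ≡ ⟪ w , q ⟫) → p ≈ₚ q
≈ₚ-from-⟪⟫ p q eq i j = trans (coeff≡⟪δ⟫ p i j) (trans (eq (δ i j)) (sym (coeff≡⟪δ⟫ q i j)))

shift : Weight → ℕ → ℕ → Weight
shift w a b i j = w (a ℕ.+ i) (b ℕ.+ j)

⟪⟫-mono-*ₚ : ∀ w c a b p → ⟪ w , mono c a b *ₚ p ⟫ ≡ c * ⟪ shift w a b , p ⟫
⟪⟫-mono-*ₚ w c a b [] = sym (ℤ.*-zeroʳ c)
⟪⟫-mono-*ₚ w c a b ((d , i , j) ∷ p) =
  trans (cong (_+_ (c * d * shift w a b i j)) (⟪⟫-mono-*ₚ w c a b p)) (regroup c d _ _)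
  where
  regroup : ∀ c d x Y → c * d * x + c * Y ≡ c * (d * x + Y)
  regroup = solve-∀

*ₚ-∷ : ∀ c a b h p → ((c , a , b) ∷ h) *ₚ p ≡ (mono c a b *ₚ p) ++ (h *ₚ p)
*ₚ-∷ c a b h p = cong (_++ (h *ₚ p)) (sym (++-identityʳ _))

⟪⟫-*ₚ-∷ : ∀ w c a b h p → ⟪ w , ((c , a , b) ∷ h) *ₚ p ⟫ ≡ c * ⟪ shift w a b , p ⟫ + ⟪ w , h *ₚ p ⟫
⟪⟫-*ₚ-∷ w c a b h p = begin
  ⟪ w , ((c , a , b) ∷ h) *ₚ p ⟫               ≡⟨ cong ⟪ w ,_⟫ (*ₚ-∷ c a b h p) ⟩
  ⟪ w , (mono c a b *ₚ p) ++ (h *ₚ p) ⟫         ≡⟨ ⟪⟫-++ w (mono c a b *ₚ p) (h *ₚ p) ⟩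
  ⟪ w , mono c a b *ₚ p ⟫ + ⟪ w , h *ₚ p ⟫      ≡⟨ cong (_+ ⟪ w , h *ₚ p ⟫) (⟪⟫-mono-*ₚ w c a b p) ⟩
  c * ⟪ shift w a b , p ⟫ + ⟪ w , h *ₚ p ⟫      ∎
  where open ≡-Reasoning

⟪⟫-*ₚ-[] : ∀ w h → ⟪ w , h *ₚ [] ⟫ ≡ + 0
⟪⟫-*ₚ-[] w [] = refl
⟪⟫-*ₚ-[] w ((c , a , b) ∷ h) = trans (⟪⟫-*ₚ-∷ w c a b h []) (cong₂ _+_ (ℤ.*-zeroʳ c) (⟪⟫-*ₚ-[] w h))

⟪⟫-*ₚ-++ˡ : ∀ w g h p → ⟪ w , (g ++ h) *ₚ p ⟫ ≡ ⟪ w , g *ₚ p ⟫ + ⟪ w , h *ₚ p ⟫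
⟪⟫-*ₚ-++ˡ w [] h p = sym (ℤ.+-identityˡ _)
⟪⟫-*ₚ-++ˡ w ((c , a , b) ∷ g) h p = begin
  ⟪ w , ((c , a , b) ∷ g ++ h) *ₚ p ⟫
    ≡⟨ ⟪⟫-*ₚ-∷ w c a b (g ++ h) p ⟩
  c * ⟪ shift w a b , p ⟫ + ⟪ w , (g ++ h) *ₚ p ⟫
    ≡⟨ cong (_+_ (c * ⟪ shift w a b , p ⟫)) (⟪⟫-*ₚ-++ˡ w g h p) ⟩
  c * ⟪ shift w a b , p ⟫ + (⟪ w , g *ₚ p ⟫ + ⟪ w , h *ₚ p ⟫)
    ≡⟨ sym (ℤ.+-assoc (c * ⟪ shift w a b , p ⟫) ⟪ w , g *ₚ p ⟫ ⟪ w , h *ₚ p ⟫) ⟩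
  c * ⟪ shift w a b , p ⟫ + ⟪ w , g *ₚ p ⟫ + ⟪ w , h *ₚ p ⟫
    ≡⟨ cong (_+ ⟪ w , h *ₚ p ⟫) (sym (⟪⟫-*ₚ-∷ w c a b g p)) ⟩
  ⟪ w , ((c , a , b) ∷ g) *ₚ p ⟫ + ⟪ w , h *ₚ p ⟫
    ∎
  where open ≡-Reasoning

⟪⟫-*ₚ-++ʳ : ∀ w h p q → ⟪ w , h *ₚ (p ++ q) ⟫ ≡ ⟪ w , h *ₚ p ⟫ + ⟪ w , h *ₚ q ⟫
⟪⟫-*ₚ-++ʳ w [] p q = refl
⟪⟫-*ₚ-++ʳ w ((c , a , b) ∷ h) p q = begin
  ⟪ w , ((c , a , b) ∷ h) *ₚ (p ++ q) ⟫
    ≡⟨ ⟪⟫-*ₚ-∷ w c a b h (p ++ q) ⟩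
  c * ⟪ shift w a b , p ++ q ⟫ + ⟪ w , h *ₚ (p ++ q) ⟫
    ≡⟨ cong₂ (λ s t → c * s + t) (⟪⟫-++ (shift w a b) p q) (⟪⟫-*ₚ-++ʳ w h p q) ⟩
  c * (⟪ shift w a b , p ⟫ + ⟪ shift w a b , q ⟫) + (⟪ w , h *ₚ p ⟫ + ⟪ w , h *ₚ q ⟫)
    ≡⟨ regroup c _ _ _ _ ⟩
  (c * ⟪ shift w a b , p ⟫ + ⟪ w , h *ₚ p ⟫) + (c * ⟪ shift w a b , q ⟫ + ⟪ w , h *ₚ q ⟫)
    ≡⟨ sym (cong₂ _+_ (⟪⟫-*ₚ-∷ w c a b h p) (⟪⟫-*ₚ-∷ w c a b h q)) ⟩
  ⟪ w , ((c , a , b) ∷ h) *ₚ p ⟫ + ⟪ w , ((c , a , b) ∷ h) *ₚ q ⟫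
    ∎
  where
  open ≡-Reasoning
  regroup : ∀ c X Y A B → c * (X + Y) + (A + B) ≡ (c * X + A) + (c * Y + B)
  regroup = solve-∀

⟪⟫-*ₚ-congʳ : ∀ w h p q → p ≈ₚ q → ⟪ w , h *ₚ p ⟫ ≡ ⟪ w , h *ₚ q ⟫
⟪⟫-*ₚ-congʳ w [] p q p≈q = refl
⟪⟫-*ₚ-congʳ w ((c , a , b) ∷ h) p q p≈q = begin
  ⟪ w , ((c , a , b) ∷ h) *ₚ p ⟫               ≡⟨ ⟪⟫-*ₚ-∷ w c a b h p ⟩
  c * ⟪ shift w a b , p ⟫ + ⟪ w , h *ₚ p ⟫      ≡⟨ cong₂ (λ s t → c * s + t) (⟪⟫-congʳ (shift w a b) p q p≈q) (⟪⟫-*ₚ-congʳ w h p q p≈q) ⟩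
  c * ⟪ shift w a b , q ⟫ + ⟪ w , h *ₚ q ⟫      ≡⟨ sym (⟪⟫-*ₚ-∷ w c a b h q) ⟩
  ⟪ w , ((c , a , b) ∷ h) *ₚ q ⟫               ∎
  where open ≡-Reasoning

⟪⟫-mono-*ₚ-*ₚ : ∀ w c a b p t → ⟪ w , (mono c a b *ₚ p) *ₚ t ⟫ ≡ c * ⟪ shift w a b , p *ₚ t ⟫
⟪⟫-mono-*ₚ-*ₚ w c a b [] t = sym (ℤ.*-zeroʳ c)
⟪⟫-mono-*ₚ-*ₚ w c a b ((d , i , j) ∷ p) t = begin
  ⟪ w , (mono c a b *ₚ ((d , i , j) ∷ p)) *ₚ t ⟫
    ≡⟨ ⟪⟫-*ₚ-∷ w (c * d) (a ℕ.+ i) (b ℕ.+ j) (mono c a b *ₚ p) t ⟩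
  c * d * ⟪ shift w (a ℕ.+ i) (b ℕ.+ j) , t ⟫ + ⟪ w , (mono c a b *ₚ p) *ₚ t ⟫
    ≡⟨ cong₂ (λ s r → c * d * s + r) (⟪⟫-congˡ shift-assoc t) (⟪⟫-mono-*ₚ-*ₚ w c a b p t) ⟩
  c * d * ⟪ shift (shift w a b) i j , t ⟫ + c * ⟪ shift w a b , p *ₚ t ⟫
    ≡⟨ regroup c d _ _ ⟩
  c * (d * ⟪ shift (shift w a b) i j , t ⟫ + ⟪ shift w a b , p *ₚ t ⟫)
    ≡⟨ cong (c *_) (sym (⟪⟫-*ₚ-∷ (shift w a b) d i j p t)) ⟩
  c * ⟪ shift w a b , ((d , i , j) ∷ p) *ₚ t ⟫
    ∎
  where
  open ≡-Reasoning
  shift-assoc : ∀ k l → shift w (a ℕ.+ i) (b ℕ.+ j) k l ≡ shift (shift w a b) i j k l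
  shift-assoc k l = cong₂ w (ℕ.+-assoc a i k) (ℕ.+-assoc b j l)
  regroup : ∀ c d x Y → c * d * x + c * Y ≡ c * (d * x + Y)
  regroup = solve-∀

⟪⟫-*ₚ-assoc : ∀ w h p t → ⟪ w , (h *ₚ p) *ₚ t ⟫ ≡ ⟪ w , h *ₚ (p *ₚ t) ⟫
⟪⟫-*ₚ-assoc w [] p t = refl
⟪⟫-*ₚ-assoc w ((c , a , b) ∷ h) p t = begin
  ⟪ w , (((c , a , b) ∷ h) *ₚ p) *ₚ t ⟫
    ≡⟨ cong (λ r → ⟪ w , r *ₚ t ⟫) (*ₚ-∷ c a b h p) ⟩
  ⟪ w , ((mono c a b *ₚ p) ++ (h *ₚ p)) *ₚ t ⟫
    ≡⟨ ⟪⟫-*ₚ-++ˡ w (mono c a b *ₚ p) (h *ₚ p) t ⟩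
  ⟪ w , (mono c a b *ₚ p) *ₚ t ⟫ + ⟪ w , (h *ₚ p) *ₚ t ⟫
    ≡⟨ cong₂ _+_ (⟪⟫-mono-*ₚ-*ₚ w c a b p t) (⟪⟫-*ₚ-assoc w h p t) ⟩
  c * ⟪ shift w a b , p *ₚ t ⟫ + ⟪ w , h *ₚ (p *ₚ t) ⟫
    ≡⟨ sym (⟪⟫-*ₚ-∷ w c a b h (p *ₚ t)) ⟩
  ⟪ w , ((c , a , b) ∷ h) *ₚ (p *ₚ t) ⟫
    ∎
  where open ≡-Reasoning

InIdeal-resp : ∀ {T} p q → p ≈ₚ q → InIdeal T q → InIdeal T p
InIdeal-resp p q p≈q (cs , cs∈T , q≈cs) = cs , cs∈T , λ i j → trans (p≈q i j) (q≈cs i j)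

InIdeal-[] : ∀ {T} → InIdeal T []
InIdeal-[] = [] , [] , λ _ _ → refl

lincomb-++ : ∀ cs ds → lincomb (cs ++ ds) ≡ lincomb cs ++ lincomb ds
lincomb-++ [] ds = refl
lincomb-++ ((h , g) ∷ cs) ds = trans (cong ((h *ₚ g) ++_) (lincomb-++ cs ds)) (sym (++-assoc (h *ₚ g) _ _))

InIdeal-++ : ∀ {T} p q → InIdeal T p → InIdeal T q → InIdeal T (p ++ q)
InIdeal-++ p q (cs , cs∈T , p≈cs) (ds , ds∈T , q≈ds) = cs ++ ds , ++⁺ cs∈T ds∈T , λ i j → begin
  coeff (p ++ q) i j                              ≡⟨ coeff-++ p q i j ⟩
  coeff p i j + coeff q i j                       ≡⟨ cong₂ _+_ (p≈cs i j) (q≈ds i j) ⟩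
  coeff (lincomb cs) i j + coeff (lincomb ds) i j ≡⟨ sym (coeff-++ (lincomb cs) (lincomb ds) i j) ⟩
  coeff (lincomb cs ++ lincomb ds) i j            ≡⟨ cong (λ r → coeff r i j) (sym (lincomb-++ cs ds)) ⟩
  coeff (lincomb (cs ++ ds)) i j                  ∎
  where open ≡-Reasoning

scaleCoefficients : Poly → List (Poly × Poly) → List (Poly × Poly)
scaleCoefficients h = map (λ hg → h *ₚ proj₁ hg , proj₂ hg)

⟪⟫-*ₚ-lincomb : ∀ w h cs → ⟪ w , h *ₚ lincomb cs ⟫ ≡ ⟪ w , lincomb (scaleCoefficients h cs) ⟫
⟪⟫-*ₚ-lincomb w h [] = ⟪⟫-*ₚ-[] w h
⟪⟫-*ₚ-lincomb w h ((g , t) ∷ cs) = begin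
  ⟪ w , h *ₚ ((g *ₚ t) ++ lincomb cs) ⟫
    ≡⟨ ⟪⟫-*ₚ-++ʳ w h (g *ₚ t) (lincomb cs) ⟩
  ⟪ w , h *ₚ (g *ₚ t) ⟫ + ⟪ w , h *ₚ lincomb cs ⟫
    ≡⟨ cong₂ _+_ (sym (⟪⟫-*ₚ-assoc w h g t)) (⟪⟫-*ₚ-lincomb w h cs) ⟩
  ⟪ w , (h *ₚ g) *ₚ t ⟫ + ⟪ w , lincomb (scaleCoefficients h cs) ⟫
    ≡⟨ sym (⟪⟫-++ w ((h *ₚ g) *ₚ t) _) ⟩
  ⟪ w , lincomb (scaleCoefficients h ((g , t) ∷ cs)) ⟫
    ∎
  where open ≡-Reasoning

InIdeal-*ₚ : ∀ {T} h p → InIdeal T p → InIdeal T (h *ₚ p)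
InIdeal-*ₚ h p (cs , cs∈T , p≈cs) =
  scaleCoefficients h cs , map⁺ cs∈T ,
  ≈ₚ-from-⟪⟫ (h *ₚ p) (lincomb (scaleCoefficients h cs)) (λ w → trans (⟪⟫-*ₚ-congʳ w h p (lincomb cs) p≈cs) (⟪⟫-*ₚ-lincomb w h cs))

InIdeal-multiple : ∀ {T} h p → p ∈ T → InIdeal T (h *ₚ p)
InIdeal-multiple h p p∈T =
  ((h , p) ∷ []) , p∈T ∷ [] , λ i j → cong (λ r → coeff r i j) (sym (++-identityʳ (h *ₚ p)))

InIdeal-⊆ : ∀ {G T} → (∀ g → g ∈ G → InIdeal T g) → ∀ f → InIdeal G f → InIdeal T f
InIdeal-⊆ {G} {T} G⊆I[T] f (cs , cs∈G , f≈cs) = InIdeal-resp f (lincomb cs) f≈cs (lincomb∈I[T] cs cs∈G)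
  where
  lincomb∈I[T] : ∀ cs → All (λ hg → proj₂ hg ∈ G) cs → InIdeal T (lincomb cs)
  lincomb∈I[T] [] [] = InIdeal-[]
  lincomb∈I[T] ((h , g) ∷ cs) (g∈G ∷ cs∈G) =
    InIdeal-++ (h *ₚ g) (lincomb cs) (InIdeal-*ₚ h g (G⊆I[T] g g∈G)) (lincomb∈I[T] cs cs∈G)

-ₚ-mono-*ₚ : ∀ d i j p → (-ₚ (mono d i j *ₚ p)) ≈ₚ (mono (- d) i j *ₚ p)
-ₚ-mono-*ₚ d i j p = ≈ₚ-from-⟪⟫ (-ₚ (mono d i j *ₚ p)) (mono (- d) i j *ₚ p) λ w → begin
  ⟪ w , -ₚ (mono d i j *ₚ p) ⟫     ≡⟨ ⟪⟫-neg w (mono d i j *ₚ p) ⟩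
  - ⟪ w , mono d i j *ₚ p ⟫        ≡⟨ cong -_ (⟪⟫-mono-*ₚ w d i j p) ⟩
  - (d * ⟪ shift w i j , p ⟫)      ≡⟨ ℤ.neg-distribˡ-* d _ ⟩
  - d * ⟪ shift w i j , p ⟫        ≡⟨ sym (⟪⟫-mono-*ₚ w (- d) i j p) ⟩
  ⟪ w , mono (- d) i j *ₚ p ⟫      ∎
  where open ≡-Reasoning

DReducesMod-InIdeal : ∀ {G} f g → DReducesMod G f g → InIdeal G f → InIdeal G g
DReducesMod-InIdeal f g (p , p∈G , _ , _ , _ , _ , d , i , j , _ , _ , g≈f-dp) f∈I =
  InIdeal-resp g (f -ₚ (mono d i j *ₚ p)) g≈f-dp
    (InIdeal-++ f (-ₚ (mono d i j *ₚ p)) f∈I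
      (InIdeal-resp (-ₚ (mono d i j *ₚ p)) (mono (- d) i j *ₚ p) (-ₚ-mono-*ₚ d i j p) (InIdeal-multiple (mono (- d) i j) p p∈G)))

Star-DReducesMod-InIdeal : ∀ {G} f h → Star (DReducesMod G) f h → InIdeal G f → InIdeal G h
Star-DReducesMod-InIdeal f .f ε f∈I = f∈I
Star-DReducesMod-InIdeal f h (_◅_ {j = g} step steps) f∈I =
  Star-DReducesMod-InIdeal g h steps (DReducesMod-InIdeal f g step f∈I)

-- Coordinates of tⁿ in ℤ[t]/((t+1)²) over the basis 1, t, from t·(u + v t) = -v + (u - 2v) t.
t^ : ℕ → ℤ × ℤ
t^ zero = + 1 , + 0
t^ (suc n) = - proj₂ (t^ n) , proj₁ (t^ n) - + 2 * proj₂ (t^ n)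

-- ⟪ ev π n , f ⟫ is the π-coordinate of tⁿ · f(t, t).
ev : (ℤ × ℤ → ℤ) → ℕ → Weight
ev π n i j = π (t^ (n ℕ.+ (i ℕ.+ j)))

EvalZero : ℕ → Poly → Set
EvalZero n f = ⟪ ev proj₁ n , f ⟫ ≡ + 0 × ⟪ ev proj₂ n , f ⟫ ≡ + 0

EvalZero-suc : ∀ n f → EvalZero n f → EvalZero (suc n) f
EvalZero-suc n f (u≡0 , v≡0) =
  trans (⟪⟫-linear (ev proj₁ n) (ev proj₂ n) (+ 0) (- + 1) (λ i j → first (ev proj₁ n i j) (ev proj₂ n i j)) f)
        (cong₂ (λ u v → + 0 * u + - + 1 * v) u≡0 v≡0) ,
  trans (⟪⟫-linear (ev proj₁ n) (ev proj₂ n) (+ 1) (- + 2) (λ i j → second (ev proj₁ n i j) (ev proj₂ n i j)) f)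
        (cong₂ (λ u v → + 1 * u + - + 2 * v) u≡0 v≡0)
  where
  first : ∀ u v → - v ≡ + 0 * u + - + 1 * v
  first = solve-∀
  second : ∀ u v → u - + 2 * v ≡ + 1 * u + - + 2 * v
  second = solve-∀

EvalZero-all : ∀ f → EvalZero 0 f → ∀ n → EvalZero n f
EvalZero-all f f↦0 zero = f↦0
EvalZero-all f f↦0 (suc n) = EvalZero-suc n f (EvalZero-all f f↦0 n)

shift-ev : ∀ π a b i j → shift (ev π 0) a b i j ≡ ev π (a ℕ.+ b) i j
shift-ev π a b i j = cong (π ∘ t^) (+-interchange a i b j)

⟪ev⟫-*ₚ-∷ : ∀ π c a b h g → ⟪ ev π (a ℕ.+ b) , g ⟫ ≡ + 0 → ⟪ ev π 0 , h *ₚ g ⟫ ≡ + 0 →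
            ⟪ ev π 0 , ((c , a , b) ∷ h) *ₚ g ⟫ ≡ + 0
⟪ev⟫-*ₚ-∷ π c a b h g head↦0 tail↦0 = begin
  ⟪ ev π 0 , ((c , a , b) ∷ h) *ₚ g ⟫               ≡⟨ ⟪⟫-*ₚ-∷ (ev π 0) c a b h g ⟩
  c * ⟪ shift (ev π 0) a b , g ⟫ + ⟪ ev π 0 , h *ₚ g ⟫ ≡⟨ cong₂ (λ s t → c * s + t) (trans (⟪⟫-congˡ (shift-ev π a b) g) head↦0) tail↦0 ⟩
  c * + 0 + + 0                                     ≡⟨ cong (_+ + 0) (ℤ.*-zeroʳ c) ⟩
  + 0                                               ∎
  where open ≡-Reasoning

EvalZero-*ₚ : ∀ g → EvalZero 0 g → ∀ h → EvalZero 0 (h *ₚ g)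
EvalZero-*ₚ g g↦0 [] = refl , refl
EvalZero-*ₚ g g↦0 ((c , a , b) ∷ h) =
  ⟪ev⟫-*ₚ-∷ proj₁ c a b h g (proj₁ shifted) (proj₁ (EvalZero-*ₚ g g↦0 h)) ,
  ⟪ev⟫-*ₚ-∷ proj₂ c a b h g (proj₂ shifted) (proj₂ (EvalZero-*ₚ g g↦0 h))
  where
  shifted : EvalZero (a ℕ.+ b) g
  shifted = EvalZero-all g g↦0 (a ℕ.+ b)

EvalZero-++ : ∀ p q → EvalZero 0 p → EvalZero 0 q → EvalZero 0 (p ++ q)
EvalZero-++ p q (p₁ , pₜ) (q₁ , qₜ) =
  trans (⟪⟫-++ (ev proj₁ 0) p q) (cong₂ _+_ p₁ q₁) ,
  trans (⟪⟫-++ (ev proj₂ 0) p q) (cong₂ _+_ pₜ qₜ)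

EvalZero-InIdeal : ∀ {G} → All (EvalZero 0) G → ∀ f → InIdeal G f → EvalZero 0 f
EvalZero-InIdeal {G} G↦0 f (cs , cs∈G , f≈cs) =
  trans (⟪⟫-congʳ (ev proj₁ 0) f (lincomb cs) f≈cs) (proj₁ (lincomb↦0 cs cs∈G)) ,
  trans (⟪⟫-congʳ (ev proj₂ 0) f (lincomb cs) f≈cs) (proj₂ (lincomb↦0 cs cs∈G))
  where
  lincomb↦0 : ∀ cs → All (λ hg → proj₂ hg ∈ G) cs → EvalZero 0 (lincomb cs)
  lincomb↦0 [] [] = refl , refl
  lincomb↦0 ((h , g) ∷ cs) (g∈G ∷ cs∈G) =
    EvalZero-++ (h *ₚ g) (lincomb cs) (EvalZero-*ₚ g (lookup G↦0 g∈G) h) (lincomb↦0 cs cs∈G)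

Irreducible : List Poly → Poly → Set
Irreducible G h = ∀ g → ¬ DReducesMod G h g

Irreducible⇒coeff≡0 : ∀ G p {a b} h → p ∈ G → IsHM p (+ 1) a b → Irreducible G h →
                      ∀ i j → coeff h (i ℕ.+ a) (j ℕ.+ b) ≡ + 0
Irreducible⇒coeff≡0 G p {a} {b} h p∈G hm irr i j with coeff h (i ℕ.+ a) (j ℕ.+ b) ℤ.≟ + 0
... | yes c≡0 = c≡0
... | no c≢0 = ⊥-elim (irr (h -ₚ (mono d i j *ₚ p))
                          (p , p∈G , + 1 , a , b , hm , d , i , j , c≢0 , sym (ℤ.*-identityʳ d) , λ _ _ → refl))
  where
  d = coeff h (i ℕ.+ a) (j ℕ.+ b)

HM-D₁ : IsHM D₁ (+ 1) 0 2
HM-D₁ = refl , (λ ()) , below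
  where
  below : ∀ i j → coeff D₁ i j ≢ + 0 → ((i , j) ≡ (0 , 2)) ⊎ ((i , j) <ᵈˡ (0 , 2))
  below 0 0 _ = inj₂ (inj₁ (ℕ.s≤s ℕ.z≤n))
  below 0 1 _ = inj₂ (inj₁ (ℕ.s≤s (ℕ.s≤s ℕ.z≤n)))
  below 0 2 _ = inj₁ refl
  below 0 (suc (suc (suc j))) c≢0 = ⊥-elim (c≢0 refl)
  below (suc i) j c≢0 = ⊥-elim (c≢0 refl)

HM-D₂ : IsHM D₂ (+ 1) 1 0
HM-D₂ = refl , (λ ()) , below
  where
  below : ∀ i j → coeff D₂ i j ≢ + 0 → ((i , j) ≡ (1 , 0)) ⊎ ((i , j) <ᵈˡ (1 , 0))
  below 0 0 c≢0 = ⊥-elim (c≢0 refl)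
  below 0 1 _ = inj₂ (inj₂ (refl , ℕ.s≤s ℕ.z≤n))
  below 0 (suc (suc j)) c≢0 = ⊥-elim (c≢0 refl)
  below 1 0 _ = inj₁ refl
  below 1 (suc j) c≢0 = ⊥-elim (c≢0 refl)
  below (suc (suc i)) j c≢0 = ⊥-elim (c≢0 refl)

linearPart : Poly → Poly
linearPart h = (coeff h 0 0 , 0 , 0) ∷ (coeff h 0 1 , 0 , 1) ∷ []

module _ (h : Poly) (irr : Irreducible (D₁ ∷ D₂ ∷ []) h) where

  private
    no-x : ∀ i j → coeff h (suc i) j ≡ + 0
    no-x i j = subst (_≡ + 0) (cong₂ (coeff h) (ℕ.+-comm i 1) (ℕ.+-identityʳ j))
                 (Irreducible⇒coeff≡0 (D₁ ∷ D₂ ∷ []) D₂ h (there (here refl)) HM-D₂ irr i j)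

    no-y² : ∀ j → coeff h 0 (suc (suc j)) ≡ + 0
    no-y² j = subst (_≡ + 0) (cong (coeff h 0) (ℕ.+-comm j 2))
                (Irreducible⇒coeff≡0 (D₁ ∷ D₂ ∷ []) D₁ h (here refl) HM-D₁ irr 0 j)

  Irreducible-D₁D₂-linear : h ≈ₚ linearPart h
  Irreducible-D₁D₂-linear 0 0 = sym (ℤ.+-identityʳ _)
  Irreducible-D₁D₂-linear 0 1 = sym (ℤ.+-identityʳ _)
  Irreducible-D₁D₂-linear 0 (suc (suc j)) = no-y² j
  Irreducible-D₁D₂-linear (suc i) j = no-x i j

  Irreducible-D₁D₂-EvalZero⇒≈0 : EvalZero 0 h → h ≈ₚ 0ₚ
  Irreducible-D₁D₂-EvalZero⇒≈0 (h₁ , hₜ) = λ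
    { 0 0 → trans (constant c₀ c₁) (trans (sym (⟪⟫-congʳ (ev proj₁ 0) h (linearPart h) Irreducible-D₁D₂-linear)) h₁)
    ; 0 1 → trans (linear c₀ c₁) (trans (sym (⟪⟫-congʳ (ev proj₂ 0) h (linearPart h) Irreducible-D₁D₂-linear)) hₜ)
    ; 0 (suc (suc j)) → no-y² j
    ; (suc i) j → no-x i j
    }
    where
    c₀ = coeff h 0 0
    c₁ = coeff h 0 1
    constant : ∀ c₀ c₁ → c₀ ≡ c₀ * + 1 + (c₁ * + 0 + + 0)
    constant = solve-∀
    linear : ∀ c₀ c₁ → c₁ ≡ c₀ * + 0 + (c₁ * + 1 + + 0)
    linear = solve-∀

-- The cofactor identities below only involve exponents ≤ 3; splitting off the cases 0,…,3
-- makes every coefficient compute, so each identity is checked by refl.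
≡-by-cases≤3 : {f g : ℕ → ℤ} → f 0 ≡ g 0 → f 1 ≡ g 1 → f 2 ≡ g 2 → f 3 ≡ g 3 →
               (∀ n → f (4 ℕ.+ n) ≡ g (4 ℕ.+ n)) → ∀ n → f n ≡ g n
≡-by-cases≤3 e₀ e₁ e₂ e₃ e₄ 0 = e₀
≡-by-cases≤3 e₀ e₁ e₂ e₃ e₄ 1 = e₁
≡-by-cases≤3 e₀ e₁ e₂ e₃ e₄ 2 = e₂
≡-by-cases≤3 e₀ e₁ e₂ e₃ e₄ 3 = e₃
≡-by-cases≤3 e₀ e₁ e₂ e₃ e₄ (suc (suc (suc (suc n)))) = e₄ n

≗₂-by-cases≤3 : {f g : ℕ → ℕ → ℤ} → (∀ j → f 0 j ≡ g 0 j) → (∀ j → f 1 j ≡ g 1 j) →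
                (∀ j → f 2 j ≡ g 2 j) → (∀ j → f 3 j ≡ g 3 j) →
                (∀ n j → f (4 ℕ.+ n) j ≡ g (4 ℕ.+ n) j) → ∀ i j → f i j ≡ g i j
≗₂-by-cases≤3 e₀ e₁ e₂ e₃ e₄ 0 = e₀
≗₂-by-cases≤3 e₀ e₁ e₂ e₃ e₄ 1 = e₁
≗₂-by-cases≤3 e₀ e₁ e₂ e₃ e₄ 2 = e₂
≗₂-by-cases≤3 e₀ e₁ e₂ e₃ e₄ 3 = e₃
≗₂-by-cases≤3 e₀ e₁ e₂ e₃ e₄ (suc (suc (suc (suc n)))) = e₄ n

1ₚ xₚ yₚ : Poly
1ₚ = mono (+ 1) 0 0
xₚ = mono (+ 1) 1 0
yₚ = mono (+ 1) 0 1

tiles⊆I[D] : ∀ t → t ∈ T₁ ∷ T₂ ∷ T₃ ∷ T₄ ∷ T₅ ∷ [] → InIdeal (D₁ ∷ D₂ ∷ []) t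
tiles⊆I[D] _ (here refl) =
  ((1ₚ , D₁) ∷ (1ₚ , D₂) ∷ []) , here refl ∷ there (here refl) ∷ [] ,
  ≗₂-by-cases≤3 (≡-by-cases≤3 refl refl refl refl (λ _ → refl)) (≡-by-cases≤3 refl refl refl refl (λ _ → refl))
                (≡-by-cases≤3 refl refl refl refl (λ _ → refl)) (≡-by-cases≤3 refl refl refl refl (λ _ → refl))
                (λ _ → ≡-by-cases≤3 refl refl refl refl (λ _ → refl))
tiles⊆I[D] _ (there (here refl)) =
  ((yₚ , D₁) ∷ (((+ 1 , 0 , 2) ∷ (+ 1 , 0 , 1) ∷ (+ 1 , 0 , 0) ∷ []) , D₂) ∷ []) , here refl ∷ there (here refl) ∷ [] ,
  ≗₂-by-cases≤3 (≡-by-cases≤3 refl refl refl refl (λ _ → refl)) (≡-by-cases≤3 refl refl refl refl (λ _ → refl))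
                (≡-by-cases≤3 refl refl refl refl (λ _ → refl)) (≡-by-cases≤3 refl refl refl refl (λ _ → refl))
                (λ _ → ≡-by-cases≤3 refl refl refl refl (λ _ → refl))
tiles⊆I[D] _ (there (there (here refl))) =
  ((1ₚ , D₁) ∷ (((+ 1 , 1 , 0) ∷ (+ 1 , 0 , 1) ∷ (+ 1 , 0 , 0) ∷ []) , D₂) ∷ []) , here refl ∷ there (here refl) ∷ [] ,
  ≗₂-by-cases≤3 (≡-by-cases≤3 refl refl refl refl (λ _ → refl)) (≡-by-cases≤3 refl refl refl refl (λ _ → refl))
                (≡-by-cases≤3 refl refl refl refl (λ _ → refl)) (≡-by-cases≤3 refl refl refl refl (λ _ → refl))
                (λ _ → ≡-by-cases≤3 refl refl refl refl (λ _ → refl))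
tiles⊆I[D] _ (there (there (there (here refl)))) =
  ((yₚ , D₁) ∷ (((+ 1 , 1 , 0) ∷ (+ 2 , 0 , 1) ∷ (+ 1 , 1 , 1) ∷ (+ 1 , 0 , 2) ∷ []) , D₂) ∷ []) , here refl ∷ there (here refl) ∷ [] ,
  ≗₂-by-cases≤3 (≡-by-cases≤3 refl refl refl refl (λ _ → refl)) (≡-by-cases≤3 refl refl refl refl (λ _ → refl))
                (≡-by-cases≤3 refl refl refl refl (λ _ → refl)) (≡-by-cases≤3 refl refl refl refl (λ _ → refl))
                (λ _ → ≡-by-cases≤3 refl refl refl refl (λ _ → refl))
tiles⊆I[D] _ (there (there (there (there (here refl))))) =
  ((1ₚ , D₁) ∷ (((+ 1 , 0 , 1) ∷ (+ 1 , 0 , 0) ∷ []) , D₂) ∷ []) , here refl ∷ there (here refl) ∷ [] ,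
  ≗₂-by-cases≤3 (≡-by-cases≤3 refl refl refl refl (λ _ → refl)) (≡-by-cases≤3 refl refl refl refl (λ _ → refl))
                (≡-by-cases≤3 refl refl refl refl (λ _ → refl)) (≡-by-cases≤3 refl refl refl refl (λ _ → refl))
                (λ _ → ≡-by-cases≤3 refl refl refl refl (λ _ → refl))

D⊆I[tiles] : ∀ g → g ∈ D₁ ∷ D₂ ∷ [] → InIdeal (T₁ ∷ T₂ ∷ T₃ ∷ T₄ ∷ T₅ ∷ []) g
D⊆I[tiles] _ (here refl) =
  ((((+ 1 , 0 , 0) ∷ (+ 1 , 0 , 1) ∷ []) , T₃) ∷ ((- + 1 , 1 , 0) ∷ [] , T₅) ∷ []) ,
  there (there (here refl)) ∷ there (there (there (there (here refl)))) ∷ [] ,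
  ≗₂-by-cases≤3 (≡-by-cases≤3 refl refl refl refl (λ _ → refl)) (≡-by-cases≤3 refl refl refl refl (λ _ → refl))
                (≡-by-cases≤3 refl refl refl refl (λ _ → refl)) (≡-by-cases≤3 refl refl refl refl (λ _ → refl))
                (λ _ → ≡-by-cases≤3 refl refl refl refl (λ _ → refl))
D⊆I[tiles] _ (there (here refl)) =
  ((1ₚ , T₁) ∷ (((- + 1 , 0 , 0) ∷ (- + 1 , 0 , 1) ∷ []) , T₃) ∷ (xₚ , T₅) ∷ []) ,
  here refl ∷ there (there (here refl)) ∷ there (there (there (there (here refl)))) ∷ [] ,
  ≗₂-by-cases≤3 (≡-by-cases≤3 refl refl refl refl (λ _ → refl)) (≡-by-cases≤3 refl refl refl refl (λ _ → refl))
                (≡-by-cases≤3 refl refl refl refl (λ _ → refl)) (≡-by-cases≤3 refl refl refl refl (λ _ → refl))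
                (λ _ → ≡-by-cases≤3 refl refl refl refl (λ _ → refl))

proposition10 : IsGroebnerBasisOf (D₁ ∷ D₂ ∷ []) (T₁ ∷ T₂ ∷ T₃ ∷ T₄ ∷ T₅ ∷ [])
proposition10 = isDGroebner , λ f → mk⇔ (InIdeal-⊆ D⊆I[tiles] f) (InIdeal-⊆ tiles⊆I[D] f)
  where
  isDGroebner : IsDGroebner (D₁ ∷ D₂ ∷ [])
  isDGroebner f f∈I h (f↠h , irr) =
    Irreducible-D₁D₂-EvalZero⇒≈0 h irr
      (EvalZero-InIdeal ((refl , refl) ∷ (refl , refl) ∷ []) h (Star-DReducesMod-InIdeal f h f↠h f∈I))
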